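{- Let $A=\{a_1,a_2,a_3,a_4,a_5\}$ be a set of positive integers with $a_1<a_2<a_3<a_4<a_5$, such that $a_i-a_{i-1}\ne 2a_1$ for all $i\in\{2,3,4,5\}$ and $a_4-a_3\ne a_2-a_1$. Then $\left|4^{\wedge}_{\pm}A\right|\ge 26$.
   Context: For a positive integer $h$ and a finite set of integers $A=\{a_1,\ldots,a_k\}$ (distinct elements), the restricted $h$-fold signed sumset is $h^{\wedge}_{\pm}A=\left\{\sum_{i=1}^k\lambda_i a_i:\lambda_i\in\{ -1,0,1\},\ \sum_{i=1}^k|\lambda_i|=h\right\}$. -}

module Defs where

open import Data.Nat using (ℕ; zero; suc)
open import Data.Integer using (ℤ; _+_; -_; +_)
open import Data.Integer.Properties using (_≟_)
open import Data.List using (List; []; _∷_; _++_; map; filter; length; deduplicate)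
open import Data.Product using (_×_; _,_; proj₁; proj₂)
import Data.Nat.Properties as ℕP
open import Relation.Binary.PropositionalEquality using (_≡_)

-- All signed sums of the list a₁,…,a_k: every choice λ ∈ {-1,0,1}^k,
-- recorded as the pair (Σ λᵢ aᵢ , Σ |λᵢ|).
signedSums : List ℤ → List (ℤ × ℕ)
signedSums [] = (+ 0 , 0) ∷ []
signedSums (a ∷ as) =
  let r = signedSums as in
  r ++ map (λ p → (a + proj₁ p , suc (proj₂ p))) r
    ++ map (λ p → (- a + proj₁ p , suc (proj₂ p))) r

-- Restricted h-fold signed sumset h^∧_± A (as a list, possibly with repetitions).
restrictedSignedSumset : ℕ → List ℤ → List ℤ
restrictedSignedSumset h as =
  map proj₁ (filter (λ p → proj₂ p ℕP.≟ h) (signedSums as))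

card : List ℤ → ℕ
card xs = length (deduplicate _≟_ xs)

-- Write g = (a₁, a₂ − a₁, …, a₅ − a₄) for the gaps, all positive. By summation by parts a signed sum
-- Σ λᵢ aᵢ equals Σ Λⱼ gⱼ, where Λ is the vector of suffix sums of λ. Two of the hypotheses say that the
-- forms g₃ − 2g₁ and g₄ − g₂ do not vanish, so each has a definite sign. In each of the four sign cases
-- there are 26 sign patterns of weight 4, listed so that consecutive differences of their Λ's are nonzero
-- nonnegative combinations of unit vectors and of the two forms (with their signs); the values are then
-- strictly increasing, hence distinct. These combinations are found by a bounded search that the type
-- checker runs.
module Submission where

open import Defs

module _ where

  open import Data.Fin using () renaming (zero to fzero; suc to fsuc)
  open import Data.Fin.Properties using (injective⇒≤)
  open import Data.Integer as ℤ
    using (ℤ; +_; -[1+_]; 0ℤ; 1ℤ; -1ℤ; ∣_∣; _+_; _-_; _*_; -_; _<_; _≤_; _≟_; +≤+)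
  import Data.Integer.Properties as ℤ
  open import Data.Integer.Tactic.RingSolver using (solve-∀)
  open import Data.List as List using (List; []; _∷_; length; deduplicate; upTo; mapMaybe)
  open import Data.List.Membership.Propositional using (_∈_)
  open import Data.List.Membership.Propositional.Properties
    using (∈-map⁺; ∈-++⁺ˡ; ∈-++⁺ʳ; ∈-filter⁺; ∈-deduplicate⁺; ∈-lookup)
  import Data.List.Membership.Setoid.Properties as Membershipₛ
  import Data.List.Properties as List
  open import Data.List.Relation.Unary.All as All using (All; []; _∷_)
  import Data.List.Relation.Unary.All.Properties as All
  open import Data.List.Relation.Unary.AllPairs as AllPairs using (AllPairs; _∷_)
  open import Data.List.Relation.Unary.Any using (here; index)
  open import Data.List.Relation.Unary.Linked as Linked using (Linked; []; [-]; _∷_)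
  open import Data.List.Relation.Unary.Linked.Properties using (Linked⇒AllPairs; map⁺; map⁻)
  open import Data.Maybe as Maybe using (Maybe; just; from-just)
  open import Data.Nat as ℕ using (ℕ; zero; suc)
  open import Data.Product using (_,_; proj₁; proj₂)
  open import Data.Sum using (_⊎_; inj₁; inj₂)
  open import Data.Vec as Vec using (Vec; []; _∷_; toList)
  import Data.Vec.Properties as Vec
  open import Data.Vec.Relation.Unary.All using ([]; _∷_) renaming (All to VecAll)
  open import Function using (_∘_; _on_)
  open import Relation.Binary.Definitions using (tri<; tri≈; tri>)
  open import Relation.Binary.PropositionalEquality
  open import Relation.Nullary using (contradiction)
  open import Relation.Nullary.Decidable using (dec⇒maybe)

  private variable
    m n h : ℕ

  infixl 6 _+ᵛ_ _-ᵛ_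
  infix 7 _·_

  _+ᵛ_ _-ᵛ_ : Vec ℤ n → Vec ℤ n → Vec ℤ n
  _+ᵛ_ = Vec.zipWith _+_
  _-ᵛ_ = Vec.zipWith _-_

  _·_ : Vec ℤ n → Vec ℤ n → ℤ
  [] · [] = 0ℤ
  (c ∷ cs) · (x ∷ xs) = c * x + cs · xs

  combination : Vec ℤ m → Vec (Vec ℤ n) m → Vec ℤ n
  combination [] [] = Vec.replicate _ 0ℤ
  combination (c ∷ cs) (f ∷ fs) = Vec.map (c *_) f +ᵛ combination cs fs

  ·-distribʳ-+ᵛ : (f g x : Vec ℤ n) → (f +ᵛ g) · x ≡ f · x + g · x
  ·-distribʳ-+ᵛ [] [] [] = refl
  ·-distribʳ-+ᵛ (a ∷ f) (b ∷ g) (x ∷ xs) =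
    trans (cong (λ u → (a + b) * x + u) (·-distribʳ-+ᵛ f g xs)) (interchange a b x (f · xs) (g · xs))
    where
    interchange : ∀ a b x u v → (a + b) * x + (u + v) ≡ (a * x + u) + (b * x + v)
    interchange = solve-∀

  ·-scaleˡ : ∀ k (f x : Vec ℤ n) → Vec.map (k *_) f · x ≡ k * (f · x)
  ·-scaleˡ k [] [] = sym (ℤ.*-zeroʳ k)
  ·-scaleˡ k (a ∷ f) (x ∷ xs) =
    trans (cong (λ u → k * a * x + u) (·-scaleˡ k f xs)) (distrib k a x (f · xs))
    where
    distrib : ∀ k a x u → k * a * x + k * u ≡ k * (a * x + u)
    distrib = solve-∀

  replicate0· : (x : Vec ℤ n) → Vec.replicate n 0ℤ · x ≡ 0ℤ
  replicate0· [] = refl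
  replicate0· (x ∷ xs) = cong (λ u → 0ℤ * x + u) (replicate0· xs)

  combination· : (cs : Vec ℤ m) (fs : Vec (Vec ℤ n) m) (x : Vec ℤ n) →
                 combination cs fs · x ≡ cs · Vec.map (_· x) fs
  combination· [] [] x = replicate0· x
  combination· (c ∷ cs) (f ∷ fs) x = begin
    (Vec.map (c *_) f +ᵛ combination cs fs) · x    ≡⟨ ·-distribʳ-+ᵛ (Vec.map (c *_) f) _ x ⟩
    Vec.map (c *_) f · x + combination cs fs · x  ≡⟨ cong₂ _+_ (·-scaleˡ c f x) (combination· cs fs x) ⟩
    c * (f · x) + cs · Vec.map (_· x) fs          ∎
    where open ≡-Reasoning

  sum≤· : (r : Vec ℕ n) {g : Vec ℤ n} → VecAll (0ℤ <_) g → + Vec.sum r ≤ Vec.map +_ r · g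
  sum≤· [] [] = ℤ.≤-refl
  sum≤· (r ∷ rs) {g ∷ gs} (0<g ∷ 0<gs) = begin
    + (r ℕ.+ Vec.sum rs)           ≡⟨ ℤ.pos-+ r (Vec.sum rs) ⟩
    + r + + Vec.sum rs             ≤⟨ ℤ.+-mono-≤ r≤r*g (sum≤· rs 0<gs) ⟩
    + r * g + Vec.map +_ rs · gs   ∎
    where
    open ℤ.≤-Reasoning
    r≤r*g : + r ≤ + r * g
    r≤r*g = subst (_≤ + r * g) (ℤ.*-identityʳ (+ r)) (ℤ.*-monoˡ-≤-nonNeg (+ r) (ℤ.i<j⇒suc[i]≤j 0<g))

  total : Vec ℤ n → ℤ
  total = Vec.foldr′ _+_ 0ℤ

  suffixSums : Vec ℤ n → Vec ℤ n
  suffixSums [] = []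
  suffixSums (c ∷ cs) = c + total cs ∷ suffixSums cs

  gapsFrom : ℤ → Vec ℤ n → Vec ℤ n
  gapsFrom b [] = []
  gapsFrom b (x ∷ xs) = x - b ∷ gapsFrom x xs

  gaps : Vec ℤ n → Vec ℤ n
  gaps = gapsFrom 0ℤ

  summationByParts : ∀ b (f x : Vec ℤ n) → f · x ≡ suffixSums f · gapsFrom b x + total f * b
  summationByParts b [] [] = refl
  summationByParts b (c ∷ f) (x ∷ xs) =
    trans (cong (λ u → c * x + u) (summationByParts x f xs))
          (regroup c (total f) x b (suffixSums f · gapsFrom x xs))
    where
    regroup : ∀ c t x b s → c * x + (s + t * x) ≡ (c + t) * (x - b) + s + (c + t) * b
    regroup = solve-∀

  ·≡suffixSums·gaps : (f x : Vec ℤ n) → f · x ≡ suffixSums f · gaps x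
  ·≡suffixSums·gaps f x = begin
    f · x                                         ≡⟨ summationByParts 0ℤ f x ⟩
    suffixSums f · gaps x + total f * 0ℤ          ≡⟨ cong (λ u → suffixSums f · gaps x + u) (ℤ.*-zeroʳ (total f)) ⟩
    suffixSums f · gaps x + 0ℤ                    ≡⟨ ℤ.+-identityʳ _ ⟩
    suffixSums f · gaps x                         ∎
    where open ≡-Reasoning

  gapsFrom-positive : ∀ b (xs : Vec ℤ n) → Linked _<_ (b ∷ toList xs) → VecAll (0ℤ <_) (gapsFrom b xs)
  gapsFrom-positive b [] _ = []
  gapsFrom-positive b (x ∷ xs) (b<x ∷ ascending) =
    subst (_< x - b) (ℤ.+-inverseʳ b) (ℤ.+-monoˡ-< (- b) b<x) ∷ gapsFrom-positive x xs ascending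

  negate : Vec ℤ n → Vec ℤ n
  negate = Vec.map (-1ℤ *_)

  positiveOrNegatedPositive : (f x : Vec ℤ n) → f · x ≢ 0ℤ → 0ℤ < f · x ⊎ 0ℤ < negate f · x
  positiveOrNegatedPositive f x f·x≢0 with ℤ.<-cmp 0ℤ (f · x)
  ... | tri< 0<f·x _ _ = inj₁ 0<f·x
  ... | tri≈ _ 0≡f·x _ = contradiction (sym 0≡f·x) f·x≢0
  ... | tri> _ _ f·x<0 =
    inj₂ (subst (0ℤ <_) (sym (trans (·-scaleˡ -1ℤ f x) (ℤ.-1*i≡-i (f · x)))) (ℤ.neg-mono-< f·x<0))

  data Sign : Set where
    ⁺ ⁻ ⁰ : Sign

  coefficient : Sign → ℤ
  coefficient ⁺ = 1ℤ
  coefficient ⁻ = -1ℤ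
  coefficient ⁰ = 0ℤ

  weight : Vec Sign n → ℕ
  weight [] = 0
  weight (⁰ ∷ s) = weight s
  weight (⁺ ∷ s) = suc (weight s)
  weight (⁻ ∷ s) = suc (weight s)

  signedSum : Vec Sign n → Vec ℤ n → ℤ
  signedSum [] [] = 0ℤ
  signedSum (⁺ ∷ s) (x ∷ xs) = x + signedSum s xs
  signedSum (⁻ ∷ s) (x ∷ xs) = - x + signedSum s xs
  signedSum (⁰ ∷ s) (x ∷ xs) = signedSum s xs

  signedSum≡· : (s : Vec Sign n) (x : Vec ℤ n) → signedSum s x ≡ Vec.map coefficient s · x
  signedSum≡· [] [] = refl
  signedSum≡· (⁺ ∷ s) (x ∷ xs) = cong₂ _+_ (sym (ℤ.*-identityˡ x)) (signedSum≡· s xs)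
  signedSum≡· (⁻ ∷ s) (x ∷ xs) = cong₂ _+_ (sym (ℤ.-1*i≡-i x)) (signedSum≡· s xs)
  signedSum≡· (⁰ ∷ s) (x ∷ xs) = trans (signedSum≡· s xs) (sym (ℤ.+-identityˡ _))

  signedSum∈signedSums : (s : Vec Sign n) (x : Vec ℤ n) → (signedSum s x , weight s) ∈ signedSums (toList x)
  signedSum∈signedSums [] [] = here refl
  signedSum∈signedSums (⁰ ∷ s) (x ∷ xs) = ∈-++⁺ˡ (signedSum∈signedSums s xs)
  signedSum∈signedSums (⁺ ∷ s) (x ∷ xs) =
    ∈-++⁺ʳ (signedSums (toList xs)) (∈-++⁺ˡ (∈-map⁺ _ (signedSum∈signedSums s xs)))
  signedSum∈signedSums (⁻ ∷ s) (x ∷ xs) =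
    ∈-++⁺ʳ (signedSums (toList xs)) (∈-++⁺ʳ _ (∈-map⁺ _ (signedSum∈signedSums s xs)))

  signedSum∈restrictedSignedSumset : (s : Vec Sign n) (x : Vec ℤ n) → weight s ≡ h →
                                     signedSum s x ∈ restrictedSignedSumset h (toList x)
  signedSum∈restrictedSignedSumset {h = h} s x weight≡h =
    ∈-map⁺ proj₁ (∈-filter⁺ (λ p → proj₂ p ℕ.≟ h) (signedSum∈signedSums s x) weight≡h)

  lookup-injective : ∀ {A : Set} (xs : List A) → AllPairs _≢_ xs →
                     ∀ i j → List.lookup xs i ≡ List.lookup xs j → i ≡ j
  lookup-injective (x ∷ xs) (x∉xs ∷ _) fzero fzero _ = refl
  lookup-injective (x ∷ xs) (x∉xs ∷ _) fzero (fsuc j) x≡xⱼ = contradiction x≡xⱼ (All.lookup x∉xs (∈-lookup j))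
  lookup-injective (x ∷ xs) (x∉xs ∷ _) (fsuc i) fzero xᵢ≡x = contradiction (sym xᵢ≡x) (All.lookup x∉xs (∈-lookup i))
  lookup-injective (x ∷ xs) (_ ∷ unique) (fsuc i) (fsuc j) xᵢ≡xⱼ = cong fsuc (lookup-injective xs unique i j xᵢ≡xⱼ)

  length≤card : {xs ys : List ℤ} → Linked _<_ xs → All (_∈ ys) xs → length xs ℕ.≤ card ys
  length≤card {xs} {ys} increasing xs⊆ys = injective⇒≤ {f = position} position-injective
    where
    xᵢ∈distinct : ∀ i → List.lookup xs i ∈ deduplicate _≟_ ys
    xᵢ∈distinct i = ∈-deduplicate⁺ _≟_ (All.lookup xs⊆ys (∈-lookup i))
    position = index ∘ xᵢ∈distinct
    position-injective : ∀ {i j} → position i ≡ position j → i ≡ j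
    position-injective {i} {j} eq =
      lookup-injective xs (AllPairs.map ℤ.<⇒≢ (Linked⇒AllPairs ℤ.<-trans increasing)) i j
        (Membershipₛ.index-injective (setoid ℤ) (xᵢ∈distinct i) (xᵢ∈distinct j) eq)

  record _≺⟨_⟩_ (p : Vec ℤ n) (E : Vec (Vec ℤ n) m) (q : Vec ℤ n) : Set where
    field
      slack          : Vec ℕ n
      multiplicities : Vec ℕ m
      decomposition  : q ≡ p +ᵛ (Vec.map +_ slack +ᵛ combination (Vec.map +_ multiplicities) E)
      nontrivial     : 1 ℕ.≤ Vec.sum slack ℕ.+ Vec.sum multiplicities

  ≺⇒< : {E : Vec (Vec ℤ n) m} {p q g : Vec ℤ n} → VecAll (0ℤ <_) g → VecAll (0ℤ <_) (Vec.map (_· g) E) →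
        p ≺⟨ E ⟩ q → p · g < q · g
  ≺⇒< {E = E} {p} {q} {g} 0<g 0<E p≺q = ℤ.suc[i]≤j⇒i<j (begin
    1ℤ + p · g                              ≡⟨ ℤ.+-comm 1ℤ (p · g) ⟩
    p · g + 1ℤ                              ≤⟨ ℤ.+-monoʳ-≤ (p · g) 1≤increment ⟩
    p · g + (s · g + c · Vec.map (_· g) E)  ≡⟨ value-decomposition ⟨
    q · g                                   ∎)
    where
    open _≺⟨_⟩_ p≺q
    open ℤ.≤-Reasoning
    s = Vec.map +_ slack
    c = Vec.map +_ multiplicities
    1≤increment : 1ℤ ≤ s · g + c · Vec.map (_· g) E
    1≤increment = begin
      1ℤ                                                  ≤⟨ +≤+ nontrivial ⟩
      + (Vec.sum slack ℕ.+ Vec.sum multiplicities)        ≡⟨ ℤ.pos-+ (Vec.sum slack) _ ⟩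
      + Vec.sum slack + + Vec.sum multiplicities          ≤⟨ ℤ.+-mono-≤ (sum≤· slack 0<g) (sum≤· multiplicities 0<E) ⟩
      s · g + c · Vec.map (_· g) E                        ∎
    value-decomposition : q · g ≡ p · g + (s · g + c · Vec.map (_· g) E)
    value-decomposition = begin-equality
      q · g                                  ≡⟨ cong (_· g) decomposition ⟩
      (p +ᵛ (s +ᵛ combination c E)) · g      ≡⟨ ·-distribʳ-+ᵛ p _ g ⟩
      p · g + (s +ᵛ combination c E) · g     ≡⟨ cong (λ u → p · g + u) (·-distribʳ-+ᵛ s _ g) ⟩
      p · g + (s · g + combination c E · g)  ≡⟨ cong (λ u → p · g + (s · g + u)) (combination· c E g) ⟩
      p · g + (s · g + c · Vec.map (_· g) E) ∎

  boundedVectors : ℕ → (m : ℕ) → List (Vec ℕ m)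
  boundedVectors b zero = [] ∷ []
  boundedVectors b (suc m) = List.cartesianProductWith _∷_ (upTo (suc b)) (boundedVectors b m)

  -- Taking absolute values is harmless: the decomposition check fails if q − p − Σ cᵢ Eᵢ has a negative entry.
  certify : (E : Vec (Vec ℤ n) m) (p q : Vec ℤ n) → Vec ℕ m → Maybe (p ≺⟨ E ⟩ q)
  certify E p q c =
    Maybe.zipWith certificate
      (dec⇒maybe (Vec.≡-dec _≟_ q (p +ᵛ (Vec.map +_ slack +ᵛ combination (Vec.map +_ c) E))))
      (dec⇒maybe (1 ℕ.≤? Vec.sum slack ℕ.+ Vec.sum c))
    where
    slack = Vec.map ∣_∣ (q -ᵛ p -ᵛ combination (Vec.map +_ c) E)
    certificate = λ eq nt → record { slack = slack ; multiplicities = c ; decomposition = eq ; nontrivial = nt }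

  step? : (E : Vec (Vec ℤ n) m) (p q : Vec ℤ n) → Maybe (p ≺⟨ E ⟩ q)
  step? E p q = List.head (mapMaybe (certify E p q) (boundedVectors 2 _))

  chain? : (E : Vec (Vec ℤ n) m) (fs : List (Vec ℤ n)) → Maybe (Linked (_≺⟨ E ⟩_) fs)
  chain? E [] = just []
  chain? E (f ∷ []) = just [-]
  chain? E (f ∷ g ∷ fs) = Maybe.zipWith _∷_ (step? E f g) (chain? E (g ∷ fs))

  gapForm : Vec Sign n → Vec ℤ n
  gapForm = suffixSums ∘ Vec.map coefficient

  record Certified (h : ℕ) (E : Vec (Vec ℤ n) m) (patterns : List (Vec Sign n)) : Set where
    field
      weights : All (λ s → weight s ≡ h) patterns
      chain   : Linked (_≺⟨ E ⟩_) (List.map gapForm patterns)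

  certified? : ∀ h (E : Vec (Vec ℤ n) m) patterns → Maybe (Certified h E patterns)
  certified? h E patterns =
    Maybe.zipWith (λ ws inc → record { weights = ws ; chain = inc })
      (dec⇒maybe (All.all? (λ s → weight s ℕ.≟ h) patterns))
      (chain? E (List.map gapForm patterns))

  length≤card-restrictedSignedSumset :
    (x : Vec ℤ n) → Linked _<_ (0ℤ ∷ toList x) →
    (E : Vec (Vec ℤ n) m) → VecAll (0ℤ <_) (Vec.map (_· gaps x) E) →
    (patterns : List (Vec Sign n)) → Certified h E patterns →
    length patterns ℕ.≤ card (restrictedSignedSumset h (toList x))
  length≤card-restrictedSignedSumset {h = h} x ascending E 0<E patterns certified =
    subst (ℕ._≤ _) (List.length-map value patterns)
      (length≤card (map⁺ values-increasing) (All.map⁺ {f = value} (All.map (λ {s} → member {s}) weights)))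
    where
    open Certified certified
    value : Vec Sign _ → ℤ
    value s = gapForm s · gaps x
    values-increasing : Linked (_<_ on value) patterns
    values-increasing = Linked.map (≺⇒< (gapsFrom-positive 0ℤ x ascending) 0<E) (map⁻ chain)
    member : ∀ {s} → weight s ≡ h → value s ∈ restrictedSignedSumset h (toList x)
    member {s} weight≡h = subst (_∈ restrictedSignedSumset h (toList x))
      (trans (signedSum≡· s x) (·≡suffixSums·gaps (Vec.map coefficient s) x))
      (signedSum∈restrictedSignedSumset s x weight≡h)

  A B : Vec ℤ 5
  A = -[1+ 1 ] ∷ 0ℤ ∷ 1ℤ ∷ 0ℤ ∷ 0ℤ ∷ []
  B = 0ℤ ∷ -1ℤ ∷ 0ℤ ∷ 1ℤ ∷ 0ℤ ∷ []

  -- solve-∀ does not unfold _·_ and gaps, hence the explicitly unfolded goals below.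
  A·gaps : ∀ x₁ x₂ x₃ x₄ x₅ → A · gaps (x₁ ∷ x₂ ∷ x₃ ∷ x₄ ∷ x₅ ∷ []) ≡ (x₃ - x₂) - + 2 * x₁
  A·gaps = expansion
    where
    expansion : ∀ x₁ x₂ x₃ x₄ x₅ →
      -[1+ 1 ] * (x₁ - 0ℤ) + (0ℤ * (x₂ - x₁) + (1ℤ * (x₃ - x₂) + (0ℤ * (x₄ - x₃) + (0ℤ * (x₅ - x₄) + 0ℤ))))
        ≡ (x₃ - x₂) - + 2 * x₁
    expansion = solve-∀

  B·gaps : ∀ x₁ x₂ x₃ x₄ x₅ → B · gaps (x₁ ∷ x₂ ∷ x₃ ∷ x₄ ∷ x₅ ∷ []) ≡ (x₄ - x₃) - (x₂ - x₁)
  B·gaps = expansion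
    where
    expansion : ∀ x₁ x₂ x₃ x₄ x₅ →
      0ℤ * (x₁ - 0ℤ) + (-1ℤ * (x₂ - x₁) + (0ℤ * (x₃ - x₂) + (1ℤ * (x₄ - x₃) + (0ℤ * (x₅ - x₄) + 0ℤ))))
        ≡ (x₄ - x₃) - (x₂ - x₁)
    expansion = solve-∀

  +-∸ : {m n : ℕ} → m ℕ.≤ n → + n - + m ≡ + (n ℕ.∸ m)
  +-∸ {m} {n} m≤n = trans (ℤ.m-n≡m⊖n n m) (ℤ.⊖-≥ m≤n)

  -≢0 : {m n : ℕ} → m ≢ n → + m - + n ≢ 0ℤ
  -≢0 m≢n = m≢n ∘ ℤ.+-injective ∘ ℤ.i-j≡0⇒i≡j _ _

  A·gaps≢0 : ∀ a₁ a₂ a₃ a₄ a₅ → a₂ ℕ.≤ a₃ → a₃ ℕ.∸ a₂ ≢ 2 ℕ.* a₁ →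
             A · gaps (+ a₁ ∷ + a₂ ∷ + a₃ ∷ + a₄ ∷ + a₅ ∷ []) ≢ 0ℤ
  A·gaps≢0 a₁ a₂ a₃ a₄ a₅ a₂≤a₃ =
    subst (_≢ 0ℤ) (sym (trans (A·gaps (+ a₁) (+ a₂) (+ a₃) (+ a₄) (+ a₅))
                              (cong₂ _-_ (+-∸ a₂≤a₃) (sym (ℤ.pos-* 2 a₁)))))
    ∘ -≢0

  B·gaps≢0 : ∀ a₁ a₂ a₃ a₄ a₅ → a₁ ℕ.≤ a₂ → a₃ ℕ.≤ a₄ → a₄ ℕ.∸ a₃ ≢ a₂ ℕ.∸ a₁ →
             B · gaps (+ a₁ ∷ + a₂ ∷ + a₃ ∷ + a₄ ∷ + a₅ ∷ []) ≢ 0ℤ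
  B·gaps≢0 a₁ a₂ a₃ a₄ a₅ a₁≤a₂ a₃≤a₄ =
    subst (_≢ 0ℤ) (sym (trans (B·gaps (+ a₁) (+ a₂) (+ a₃) (+ a₄) (+ a₅))
                              (cong₂ _-_ (+-∸ a₃≤a₄) (+-∸ a₁≤a₂))))
    ∘ -≢0

  -- The superscripts are the signs of A · gaps x and B · gaps x.
  patterns⁺⁺ : List (Vec Sign 5)
  patterns⁺⁺ =
      (⁰ ∷ ⁻ ∷ ⁻ ∷ ⁻ ∷ ⁻ ∷ []) ∷ (⁻ ∷ ⁰ ∷ ⁻ ∷ ⁻ ∷ ⁻ ∷ []) ∷ (⁺ ∷ ⁰ ∷ ⁻ ∷ ⁻ ∷ ⁻ ∷ []) ∷ (⁻ ∷ ⁻ ∷ ⁰ ∷ ⁻ ∷ ⁻ ∷ []) ∷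
      (⁺ ∷ ⁻ ∷ ⁰ ∷ ⁻ ∷ ⁻ ∷ []) ∷ (⁻ ∷ ⁺ ∷ ⁰ ∷ ⁻ ∷ ⁻ ∷ []) ∷ (⁺ ∷ ⁺ ∷ ⁰ ∷ ⁻ ∷ ⁻ ∷ []) ∷ (⁻ ∷ ⁰ ∷ ⁺ ∷ ⁻ ∷ ⁻ ∷ []) ∷
      (⁺ ∷ ⁰ ∷ ⁺ ∷ ⁻ ∷ ⁻ ∷ []) ∷ (⁰ ∷ ⁺ ∷ ⁺ ∷ ⁻ ∷ ⁻ ∷ []) ∷ (⁻ ∷ ⁻ ∷ ⁺ ∷ ⁰ ∷ ⁻ ∷ []) ∷ (⁻ ∷ ⁻ ∷ ⁺ ∷ ⁻ ∷ ⁰ ∷ []) ∷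
      (⁺ ∷ ⁻ ∷ ⁺ ∷ ⁻ ∷ ⁰ ∷ []) ∷ (⁻ ∷ ⁺ ∷ ⁺ ∷ ⁻ ∷ ⁰ ∷ []) ∷ (⁺ ∷ ⁻ ∷ ⁻ ∷ ⁺ ∷ ⁰ ∷ []) ∷ (⁻ ∷ ⁺ ∷ ⁻ ∷ ⁺ ∷ ⁰ ∷ []) ∷
      (⁻ ∷ ⁺ ∷ ⁻ ∷ ⁰ ∷ ⁺ ∷ []) ∷ (⁺ ∷ ⁺ ∷ ⁻ ∷ ⁰ ∷ ⁺ ∷ []) ∷ (⁰ ∷ ⁻ ∷ ⁻ ∷ ⁺ ∷ ⁺ ∷ []) ∷ (⁻ ∷ ⁰ ∷ ⁻ ∷ ⁺ ∷ ⁺ ∷ []) ∷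
      (⁺ ∷ ⁰ ∷ ⁻ ∷ ⁺ ∷ ⁺ ∷ []) ∷ (⁻ ∷ ⁻ ∷ ⁰ ∷ ⁺ ∷ ⁺ ∷ []) ∷ (⁺ ∷ ⁻ ∷ ⁰ ∷ ⁺ ∷ ⁺ ∷ []) ∷ (⁻ ∷ ⁺ ∷ ⁰ ∷ ⁺ ∷ ⁺ ∷ []) ∷
      (⁺ ∷ ⁺ ∷ ⁰ ∷ ⁺ ∷ ⁺ ∷ []) ∷ (⁻ ∷ ⁰ ∷ ⁺ ∷ ⁺ ∷ ⁺ ∷ []) ∷ []

  patterns⁺⁻ : List (Vec Sign 5)
  patterns⁺⁻ =
      (⁰ ∷ ⁻ ∷ ⁻ ∷ ⁻ ∷ ⁻ ∷ []) ∷ (⁻ ∷ ⁰ ∷ ⁻ ∷ ⁻ ∷ ⁻ ∷ []) ∷ (⁺ ∷ ⁰ ∷ ⁻ ∷ ⁻ ∷ ⁻ ∷ []) ∷ (⁻ ∷ ⁻ ∷ ⁰ ∷ ⁻ ∷ ⁻ ∷ []) ∷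
      (⁻ ∷ ⁻ ∷ ⁻ ∷ ⁰ ∷ ⁻ ∷ []) ∷ (⁺ ∷ ⁻ ∷ ⁻ ∷ ⁰ ∷ ⁻ ∷ []) ∷ (⁻ ∷ ⁺ ∷ ⁰ ∷ ⁻ ∷ ⁻ ∷ []) ∷ (⁻ ∷ ⁺ ∷ ⁻ ∷ ⁰ ∷ ⁻ ∷ []) ∷
      (⁻ ∷ ⁺ ∷ ⁻ ∷ ⁻ ∷ ⁰ ∷ []) ∷ (⁺ ∷ ⁺ ∷ ⁻ ∷ ⁻ ∷ ⁰ ∷ []) ∷ (⁻ ∷ ⁰ ∷ ⁻ ∷ ⁻ ∷ ⁺ ∷ []) ∷ (⁺ ∷ ⁰ ∷ ⁻ ∷ ⁻ ∷ ⁺ ∷ []) ∷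
      (⁻ ∷ ⁻ ∷ ⁰ ∷ ⁻ ∷ ⁺ ∷ []) ∷ (⁻ ∷ ⁻ ∷ ⁻ ∷ ⁰ ∷ ⁺ ∷ []) ∷ (⁺ ∷ ⁻ ∷ ⁻ ∷ ⁰ ∷ ⁺ ∷ []) ∷ (⁻ ∷ ⁺ ∷ ⁰ ∷ ⁻ ∷ ⁺ ∷ []) ∷
      (⁻ ∷ ⁺ ∷ ⁻ ∷ ⁰ ∷ ⁺ ∷ []) ∷ (⁺ ∷ ⁺ ∷ ⁻ ∷ ⁰ ∷ ⁺ ∷ []) ∷ (⁻ ∷ ⁰ ∷ ⁻ ∷ ⁺ ∷ ⁺ ∷ []) ∷ (⁺ ∷ ⁰ ∷ ⁻ ∷ ⁺ ∷ ⁺ ∷ []) ∷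
      (⁻ ∷ ⁻ ∷ ⁰ ∷ ⁺ ∷ ⁺ ∷ []) ∷ (⁺ ∷ ⁻ ∷ ⁰ ∷ ⁺ ∷ ⁺ ∷ []) ∷ (⁻ ∷ ⁺ ∷ ⁺ ∷ ⁰ ∷ ⁺ ∷ []) ∷ (⁻ ∷ ⁺ ∷ ⁰ ∷ ⁺ ∷ ⁺ ∷ []) ∷
      (⁺ ∷ ⁺ ∷ ⁰ ∷ ⁺ ∷ ⁺ ∷ []) ∷ (⁻ ∷ ⁰ ∷ ⁺ ∷ ⁺ ∷ ⁺ ∷ []) ∷ []

  patterns⁻⁺ : List (Vec Sign 5)
  patterns⁻⁺ =
      (⁰ ∷ ⁻ ∷ ⁻ ∷ ⁻ ∷ ⁻ ∷ []) ∷ (⁻ ∷ ⁰ ∷ ⁻ ∷ ⁻ ∷ ⁻ ∷ []) ∷ (⁻ ∷ ⁻ ∷ ⁰ ∷ ⁻ ∷ ⁻ ∷ []) ∷ (⁺ ∷ ⁰ ∷ ⁻ ∷ ⁻ ∷ ⁻ ∷ []) ∷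
      (⁰ ∷ ⁺ ∷ ⁻ ∷ ⁻ ∷ ⁻ ∷ []) ∷ (⁻ ∷ ⁺ ∷ ⁰ ∷ ⁻ ∷ ⁻ ∷ []) ∷ (⁻ ∷ ⁰ ∷ ⁺ ∷ ⁻ ∷ ⁻ ∷ []) ∷ (⁺ ∷ ⁺ ∷ ⁰ ∷ ⁻ ∷ ⁻ ∷ []) ∷
      (⁺ ∷ ⁰ ∷ ⁺ ∷ ⁻ ∷ ⁻ ∷ []) ∷ (⁰ ∷ ⁺ ∷ ⁺ ∷ ⁻ ∷ ⁻ ∷ []) ∷ (⁺ ∷ ⁻ ∷ ⁺ ∷ ⁰ ∷ ⁻ ∷ []) ∷ (⁻ ∷ ⁺ ∷ ⁺ ∷ ⁰ ∷ ⁻ ∷ []) ∷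
      (⁻ ∷ ⁺ ∷ ⁺ ∷ ⁻ ∷ ⁰ ∷ []) ∷ (⁺ ∷ ⁻ ∷ ⁻ ∷ ⁺ ∷ ⁰ ∷ []) ∷ (⁻ ∷ ⁺ ∷ ⁻ ∷ ⁺ ∷ ⁰ ∷ []) ∷ (⁻ ∷ ⁺ ∷ ⁻ ∷ ⁰ ∷ ⁺ ∷ []) ∷
      (⁰ ∷ ⁻ ∷ ⁻ ∷ ⁺ ∷ ⁺ ∷ []) ∷ (⁻ ∷ ⁰ ∷ ⁻ ∷ ⁺ ∷ ⁺ ∷ []) ∷ (⁻ ∷ ⁻ ∷ ⁰ ∷ ⁺ ∷ ⁺ ∷ []) ∷ (⁺ ∷ ⁰ ∷ ⁻ ∷ ⁺ ∷ ⁺ ∷ []) ∷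
      (⁰ ∷ ⁺ ∷ ⁻ ∷ ⁺ ∷ ⁺ ∷ []) ∷ (⁻ ∷ ⁺ ∷ ⁰ ∷ ⁺ ∷ ⁺ ∷ []) ∷ (⁻ ∷ ⁰ ∷ ⁺ ∷ ⁺ ∷ ⁺ ∷ []) ∷ (⁺ ∷ ⁺ ∷ ⁰ ∷ ⁺ ∷ ⁺ ∷ []) ∷
      (⁺ ∷ ⁰ ∷ ⁺ ∷ ⁺ ∷ ⁺ ∷ []) ∷ (⁰ ∷ ⁺ ∷ ⁺ ∷ ⁺ ∷ ⁺ ∷ []) ∷ []

  patterns⁻⁻ : List (Vec Sign 5)
  patterns⁻⁻ =
      (⁰ ∷ ⁻ ∷ ⁻ ∷ ⁻ ∷ ⁻ ∷ []) ∷ (⁻ ∷ ⁰ ∷ ⁻ ∷ ⁻ ∷ ⁻ ∷ []) ∷ (⁻ ∷ ⁻ ∷ ⁰ ∷ ⁻ ∷ ⁻ ∷ []) ∷ (⁺ ∷ ⁰ ∷ ⁻ ∷ ⁻ ∷ ⁻ ∷ []) ∷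
      (⁺ ∷ ⁻ ∷ ⁰ ∷ ⁻ ∷ ⁻ ∷ []) ∷ (⁺ ∷ ⁻ ∷ ⁻ ∷ ⁰ ∷ ⁻ ∷ []) ∷ (⁻ ∷ ⁺ ∷ ⁰ ∷ ⁻ ∷ ⁻ ∷ []) ∷ (⁻ ∷ ⁰ ∷ ⁺ ∷ ⁻ ∷ ⁻ ∷ []) ∷
      (⁻ ∷ ⁻ ∷ ⁺ ∷ ⁰ ∷ ⁻ ∷ []) ∷ (⁻ ∷ ⁻ ∷ ⁰ ∷ ⁺ ∷ ⁻ ∷ []) ∷ (⁻ ∷ ⁻ ∷ ⁰ ∷ ⁻ ∷ ⁺ ∷ []) ∷ (⁺ ∷ ⁰ ∷ ⁻ ∷ ⁻ ∷ ⁺ ∷ []) ∷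
      (⁺ ∷ ⁻ ∷ ⁰ ∷ ⁻ ∷ ⁺ ∷ []) ∷ (⁺ ∷ ⁻ ∷ ⁻ ∷ ⁰ ∷ ⁺ ∷ []) ∷ (⁻ ∷ ⁺ ∷ ⁰ ∷ ⁻ ∷ ⁺ ∷ []) ∷ (⁻ ∷ ⁰ ∷ ⁺ ∷ ⁻ ∷ ⁺ ∷ []) ∷
      (⁻ ∷ ⁻ ∷ ⁺ ∷ ⁰ ∷ ⁺ ∷ []) ∷ (⁻ ∷ ⁻ ∷ ⁰ ∷ ⁺ ∷ ⁺ ∷ []) ∷ (⁺ ∷ ⁰ ∷ ⁻ ∷ ⁺ ∷ ⁺ ∷ []) ∷ (⁰ ∷ ⁺ ∷ ⁻ ∷ ⁺ ∷ ⁺ ∷ []) ∷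
      (⁻ ∷ ⁺ ∷ ⁺ ∷ ⁰ ∷ ⁺ ∷ []) ∷ (⁻ ∷ ⁺ ∷ ⁰ ∷ ⁺ ∷ ⁺ ∷ []) ∷ (⁻ ∷ ⁰ ∷ ⁺ ∷ ⁺ ∷ ⁺ ∷ []) ∷ (⁺ ∷ ⁺ ∷ ⁰ ∷ ⁺ ∷ ⁺ ∷ []) ∷
      (⁺ ∷ ⁰ ∷ ⁺ ∷ ⁺ ∷ ⁺ ∷ []) ∷ (⁰ ∷ ⁺ ∷ ⁺ ∷ ⁺ ∷ ⁺ ∷ []) ∷ []

  certified⁺⁺ : Certified 4 (A ∷ B ∷ []) patterns⁺⁺
  certified⁺⁺ = from-just (certified? 4 (A ∷ B ∷ []) patterns⁺⁺)

  certified⁺⁻ : Certified 4 (A ∷ negate B ∷ []) patterns⁺⁻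
  certified⁺⁻ = from-just (certified? 4 (A ∷ negate B ∷ []) patterns⁺⁻)

  certified⁻⁺ : Certified 4 (negate A ∷ B ∷ []) patterns⁻⁺
  certified⁻⁺ = from-just (certified? 4 (negate A ∷ B ∷ []) patterns⁻⁺)

  certified⁻⁻ : Certified 4 (negate A ∷ negate B ∷ []) patterns⁻⁻
  certified⁻⁻ = from-just (certified? 4 (negate A ∷ negate B ∷ []) patterns⁻⁻)

  26≤card-restrictedSignedSumset : (x : Vec ℤ 5) → Linked _<_ (0ℤ ∷ toList x) →
                                   A · gaps x ≢ 0ℤ → B · gaps x ≢ 0ℤ →
                                   26 ℕ.≤ card (restrictedSignedSumset 4 (toList x))
  26≤card-restrictedSignedSumset x ascending A≢0 B≢0
    with positiveOrNegatedPositive A (gaps x) A≢0 | positiveOrNegatedPositive B (gaps x) B≢0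
  ... | inj₁ 0<A  | inj₁ 0<B  = length≤card-restrictedSignedSumset x ascending _ (0<A ∷ 0<B ∷ []) _ certified⁺⁺
  ... | inj₁ 0<A  | inj₂ 0<−B = length≤card-restrictedSignedSumset x ascending _ (0<A ∷ 0<−B ∷ []) _ certified⁺⁻
  ... | inj₂ 0<−A | inj₁ 0<B  = length≤card-restrictedSignedSumset x ascending _ (0<−A ∷ 0<B ∷ []) _ certified⁻⁺
  ... | inj₂ 0<−A | inj₂ 0<−B = length≤card-restrictedSignedSumset x ascending _ (0<−A ∷ 0<−B ∷ []) _ certified⁻⁻

open import Data.Nat using (ℕ; _<_; _≤_; _*_; _∸_)
open import Data.Nat.Properties using (<⇒≤)
open import Data.List using (_∷_; [])
open import Data.List.Relation.Unary.Linked using ([-]; _∷_)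
open import Data.Integer using (+_; +<+)
open import Data.Vec using ([]; _∷_)
open import Relation.Binary.PropositionalEquality using (_≢_)

lemma3p6 : (a₁ a₂ a₃ a₄ a₅ : ℕ) → 0 < a₁ → a₁ < a₂ → a₂ < a₃ → a₃ < a₄ → a₄ < a₅
    → a₂ ∸ a₁ ≢ 2 * a₁ → a₃ ∸ a₂ ≢ 2 * a₁ → a₄ ∸ a₃ ≢ 2 * a₁ → a₅ ∸ a₄ ≢ 2 * a₁
    → a₄ ∸ a₃ ≢ a₂ ∸ a₁
    → 26 ≤ card (restrictedSignedSumset 4 (+ a₁ ∷ + a₂ ∷ + a₃ ∷ + a₄ ∷ + a₅ ∷ []))
lemma3p6 a₁ a₂ a₃ a₄ a₅ 0<a₁ a₁<a₂ a₂<a₃ a₃<a₄ a₄<a₅ _ a₃∸a₂≢2a₁ _ _ a₄∸a₃≢a₂∸a₁ =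
  26≤card-restrictedSignedSumset (+ a₁ ∷ + a₂ ∷ + a₃ ∷ + a₄ ∷ + a₅ ∷ [])
    (+<+ 0<a₁ ∷ +<+ a₁<a₂ ∷ +<+ a₂<a₃ ∷ +<+ a₃<a₄ ∷ +<+ a₄<a₅ ∷ [-])
    (A·gaps≢0 a₁ a₂ a₃ a₄ a₅ (<⇒≤ a₂<a₃) a₃∸a₂≢2a₁)
    (B·gaps≢0 a₁ a₂ a₃ a₄ a₅ (<⇒≤ a₁<a₂) (<⇒≤ a₃<a₄) a₄∸a₃≢a₂∸a₁)
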